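{- Let $D$ be a strongly connected balanced bipartite digraph of order $2a\geq 8$ with partite sets $X$ and $Y$. If $D$ is not a directed cycle and $\max\{d(x),d(y)\}\geq 2a-2$ for every dominating pair of vertices $\{x,y\}$, then $D$ contains a non-hamiltonian directed cycle of length at least 4.
   Context: Digraphs are finite, without loops or multiple arcs (2-cycles allowed). $d(x)=d^+(x)+d^-(x)$. A pair of distinct vertices $\{x,y\}$ is dominating if there is a vertex $z$ with $x\to z$ and $y\to z$. A non-hamiltonian cycle is a directed cycle that does not contain all vertices of $D$. -}

module Defs where

open import Data.Nat using (ℕ; suc; _+_; _≤_; _<_; _∸_; _⊔_)
open import Data.Nat.DivMod using (_mod_)
open import Data.Bool using (Bool; true; false; T; if_then_else_)
open import Data.Fin using (Fin; toℕ)
open import Data.List using (List; map)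
open import Data.Nat.ListAction using (sum)
open import Data.List.Base using (allFin)
open import Data.Product using (Σ; ∃; _×_; _,_)
open import Relation.Binary.PropositionalEquality using (_≡_; _≢_)
open import Function.Definitions using (Injective)

-- Loops are forbidden;
-- 2-cycles (x → y and y → x) are allowed, multiple arcs impossible.
record Digraph (n : ℕ) : Set where
  field
    arc    : Fin n → Fin n → Bool
    noLoop : ∀ x → arc x x ≡ false
open Digraph public

_⟶[_]_ : ∀ {n} → Fin n → Digraph n → Fin n → Set
x ⟶[ D ] y = T (arc D x y)

count : ∀ {n} → (Fin n → Bool) → ℕ
count {n} p = sum (map (λ v → if p v then 1 else 0) (allFin n))

outdeg indeg deg : ∀ {n} → Digraph n → Fin n → ℕ
outdeg D x = count (λ y → arc D x y)
indeg  D x = count (λ y → arc D y x)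
deg D x = outdeg D x + indeg D x

data Reach {n} (D : Digraph n) : Fin n → Fin n → Set where
  here : ∀ {u} → Reach D u u
  step : ∀ {u w v} → u ⟶[ D ] w → Reach D w v → Reach D u v

StronglyConnected : ∀ {n} → Digraph n → Set
StronglyConnected D = ∀ u v → Reach D u v

-- D is a balanced bipartite digraph of order a + a with partite sets
-- X = {v | side v ≡ true}, Y = {v | side v ≡ false}, |X| = |Y| = a,
-- every arc goes between X and Y.
BalancedBipartite : (a : ℕ) → Digraph (a + a) → (Fin (a + a) → Bool) → Set
BalancedBipartite a D side =
  count side ≡ a × (∀ x y → x ⟶[ D ] y → side x ≢ side y)

nextIdx : ∀ {m} → Fin (suc m) → Fin (suc m)
nextIdx {m} i = suc (toℕ i) mod (suc m)

record Cycle {n} (D : Digraph n) (m : ℕ) : Set where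
  field
    vtx      : Fin (suc m) → Fin n
    len≥2    : 2 ≤ suc m
    distinct : Injective _≡_ _≡_ vtx
    arcs     : ∀ i → vtx i ⟶[ D ] vtx (nextIdx i)
open Cycle public

-- D itself is a directed cycle: D has a hamiltonian cycle C and every
-- arc of D is an arc of C.
IsDirectedCycle : ∀ {n} → Digraph n → Set
IsDirectedCycle {n} D =
  Σ ℕ λ m → Σ (Cycle D m) λ C → suc m ≡ n × (∀ x y → x ⟶[ D ] y →
    Σ (Fin (suc m)) λ i → (vtx C i ≡ x) × (vtx C (nextIdx i) ≡ y))

DominatingPair : ∀ {n} → Digraph n → Fin n → Fin n → Set
DominatingPair D x y = x ≢ y × ∃ λ z → (x ⟶[ D ] z) × (y ⟶[ D ] z)

-- D contains a non-hamiltonian directed cycle of length at least 4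
-- (a cycle of length L = suc m on distinct vertices is non-hamiltonian iff L < n)
HasNonHamCycleLen≥4 : ∀ {n} → Digraph n → Set
HasNonHamCycleLen≥4 {n} D =
  Σ ℕ λ m → Cycle D m × 4 ≤ suc m × suc m < n

module Submission where

-- If no two distinct vertices have a common out-neighbour, every vertex has in-degree at most one,
-- and strong connectivity then forces D to be a directed cycle.  Otherwise the degree condition
-- yields a vertex x with d(x) ≥ 2a − 2 ≥ 6, hence with three out- or three in-neighbours.
-- If some arc at x lies on no 2-cycle, closing it by a path gives a cycle through x; its length is
-- even and not 2, so at least 4.  If that cycle is hamiltonian, a third out- (in-)neighbour of x is
-- a chord, which cuts off a shorter cycle that still has length at least 4 because the bipartite
-- digraph has no directed triangles.  If every arc at x lies on a 2-cycle, three out-neighbours of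
-- x are pairwise dominating (they all point to x), so two of them, p and q, have degree ≥ 2a − 2;
-- as all neighbours of p and q lie in the partite set of x, counting gives y ≠ x with p → y → q or
-- q → y → p, i.e. the 4-cycle x p y q or x q y p.

open import Defs
open import Data.Nat using (ℕ; zero; suc; _+_; _≤_; _<_; _∸_; _⊔_; _≤?_; z≤n; s≤s; s≤s⁻¹)
open import Data.Nat.Properties hiding (_≟_)
open import Data.Nat.DivMod using (_%_; m<n⇒m%n≡m; n%n≡0)
open import Data.Nat.ListAction using (sum)
open import Data.Nat.Tactic.RingSolver using (solve-∀)
open import Data.Bool using (Bool; true; false; T; not; if_then_else_; _∧_; _∨_)
open import Data.Bool.Properties using (T?; T-∧; T-∨; ¬-not; not-involutive)
open import Data.Unit using (tt)
open import Data.Fin using (Fin; toℕ; fromℕ; fromℕ<; inject₁; punchOut) renaming (zero to fz; suc to fs)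
open import Data.Fin.Properties
  using (_≟_; any?; toℕ-fromℕ; toℕ-fromℕ<; toℕ-inject₁; toℕ-injective; toℕ<n; injective⇒≤; punchOut-injective)
open import Data.List using (List; []; _∷_; length)
open import Data.List.Properties using (map-tabulate)
open import Data.List.Membership.Propositional using (_∉_)
open import Data.List.Relation.Unary.Any using (here; there)
open import Data.Product using (Σ; ∃; _×_; _,_; proj₁; proj₂; uncurry)
open import Data.Sum using (_⊎_; inj₁; inj₂; [_,_]′)
open import Data.Empty using (⊥-elim)
open import Function using (_∘_; id)
open import Function.Bundles using (Equivalence)
open import Relation.Nullary using (¬_; Dec; does; yes; no; ¬?)
open import Relation.Nullary.Decidable using (_×-dec_; decidable-stable)
open import Relation.Binary.PropositionalEquality

count-suc : ∀ {n} (p : Fin (suc n) → Bool) → count p ≡ (if p fz then 1 else 0) + count (p ∘ fs)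
count-suc p = cong ((if p fz then 1 else 0) +_) (cong sum (trans (map-tabulate fs χ) (sym (map-tabulate id (χ ∘ fs)))))
  where χ = λ v → if p v then 1 else 0

count-mono : ∀ {n} {p q : Fin n → Bool} → (∀ v → T (p v) → T (q v)) → count p ≤ count q
count-mono {zero} _ = z≤n
count-mono {suc n} {p} {q} p⊆q rewrite count-suc p | count-suc q with p fz | q fz | p⊆q fz
... | false | false | _  = count-mono (p⊆q ∘ fs)
... | false | true  | _  = m≤n⇒m≤1+n (count-mono (p⊆q ∘ fs))
... | true  | false | pq = ⊥-elim (pq tt)
... | true  | true  | _  = s≤s (count-mono (p⊆q ∘ fs))

count-∨+∧ : ∀ {n} (p q : Fin n → Bool) →
  count (λ v → p v ∨ q v) + count (λ v → p v ∧ q v) ≡ count p + count q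
count-∨+∧ {zero} p q = refl
count-∨+∧ {suc n} p q
  rewrite count-suc (λ v → p v ∨ q v) | count-suc (λ v → p v ∧ q v) | count-suc p | count-suc q
  with p fz | q fz | count-∨+∧ (p ∘ fs) (q ∘ fs)
... | false | false | ih = ih
... | false | true  | ih = trans (cong suc ih) (sym (+-suc _ _))
... | true  | false | ih = cong suc ih
... | true  | true  | ih = cong suc (trans (+-suc _ _) (trans (cong suc ih) (sym (+-suc _ _))))

count-not : ∀ {n} (p : Fin n → Bool) → count p + count (not ∘ p) ≡ n
count-not {zero} p = refl
count-not {suc n} p rewrite count-suc p | count-suc (not ∘ p) with p fz | count-not (p ∘ fs)
... | false | ih = trans (+-suc _ _) (cong suc ih)
... | true  | ih = cong suc ih

0<count⇒∃ : ∀ {n} (p : Fin n → Bool) → 0 < count p → ∃ λ v → T (p v)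
0<count⇒∃ {suc n} p pos rewrite count-suc p with p fz in pz
... | true  = fz , subst T (sym pz) tt
... | false with 0<count⇒∃ (p ∘ fs) pos
...   | v , pv = fs v , pv

except : ∀ {n} → Fin n → (Fin n → Bool) → Fin n → Bool
except u p v = not (does (v ≟ u)) ∧ p v

count≤suc-count-except : ∀ {n} (p : Fin n → Bool) u → count p ≤ suc (count (except u p))
count≤suc-count-except {suc n} p fz rewrite count-suc p | count-suc (except fz p) with p fz
... | false = n≤1+n _
... | true  = ≤-refl
count≤suc-count-except {suc n} p (fs u) rewrite count-suc p | count-suc (except (fs u) p) with p fz
... | false = count≤suc-count-except (p ∘ fs) u
... | true  = s≤s (count≤suc-count-except (p ∘ fs) u)

length<count⇒∃∉ : ∀ {n} (p : Fin n → Bool) (xs : List (Fin n)) → length xs < count p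
                → ∃ λ v → T (p v) × v ∉ xs
length<count⇒∃∉ p [] pos with 0<count⇒∃ p pos
... | v , pv = v , pv , λ ()
length<count⇒∃∉ p (u ∷ xs) long
  with length<count⇒∃∉ (except u p) xs (≤-pred (≤-trans long (count≤suc-count-except p u)))
... | v , pv , v∉xs with v ≟ u
...   | no v≢u = v , pv , λ { (here v≡u) → v≢u v≡u ; (there v∈xs) → v∉xs v∈xs }
...   | yes _  = ⊥-elim pv

3≤count⇒three : ∀ {n} (p : Fin n → Bool) → 3 ≤ count p
              → ∃ λ u → ∃ λ v → ∃ λ w → (T (p u) × T (p v) × T (p w)) × (u ≢ v × u ≢ w × v ≢ w)
3≤count⇒three p 3≤ with length<count⇒∃∉ p [] (≤-trans (s≤s z≤n) 3≤)
... | u , pu , _ with length<count⇒∃∉ p (u ∷ []) (≤-trans (s≤s (s≤s z≤n)) 3≤)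
... | v , pv , v∉ with length<count⇒∃∉ p (u ∷ v ∷ []) 3≤
... | w , pw , w∉ = u , v , w , (pu , pv , pw) ,
  (λ u≡v → v∉ (here (sym u≡v))) , (λ u≡w → w∉ (here (sym u≡w))) , (λ v≡w → w∉ (there (here (sym v≡w))))

≢0∧≢1⇒≥2 : ∀ {k} → k ≢ 0 → k ≢ 1 → 2 ≤ k
≢0∧≢1⇒≥2 {0}           k≢0 _   = ⊥-elim (k≢0 refl)
≢0∧≢1⇒≥2 {1}           _   k≢1 = ⊥-elim (k≢1 refl)
≢0∧≢1⇒≥2 {suc (suc k)} _   _   = s≤s (s≤s z≤n)

≢0∧≢1∧≢2⇒≥3 : ∀ {k} → k ≢ 0 → k ≢ 1 → k ≢ 2 → 3 ≤ k
≢0∧≢1∧≢2⇒≥3 {0}                 k≢0 _   _   = ⊥-elim (k≢0 refl)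
≢0∧≢1∧≢2⇒≥3 {1}                 _   k≢1 _   = ⊥-elim (k≢1 refl)
≢0∧≢1∧≢2⇒≥3 {2}                 _   _   k≢2 = ⊥-elim (k≢2 refl)
≢0∧≢1∧≢2⇒≥3 {suc (suc (suc k))} _   _   _   = s≤s (s≤s (s≤s z≤n))

≤⊔⇒≤⊎≤ : ∀ {k m n} → k ≤ m ⊔ n → k ≤ m ⊎ k ≤ n
≤⊔⇒≤⊎≤ {k} {m} {n} k≤ with ⊔-sel m n
... | inj₁ m⊔n≡m = inj₁ (subst (k ≤_) m⊔n≡m k≤)
... | inj₂ m⊔n≡n = inj₂ (subst (k ≤_) m⊔n≡n k≤)

6≤m+n⇒3≤m⊎3≤n : ∀ {m n} → 6 ≤ m + n → 3 ≤ m ⊎ 3 ≤ n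
6≤m+n⇒3≤m⊎3≤n {m} {n} 6≤m+n with 3 ≤? m | 3 ≤? n
... | yes 3≤m | _       = inj₁ 3≤m
... | no  _   | yes 3≤n = inj₂ 3≤n
... | no  3≰m | no  3≰n =
  ⊥-elim (≤⇒≯ (≤-trans 6≤m+n (+-mono-≤ (s≤s⁻¹ (≰⇒> 3≰m)) (s≤s⁻¹ (≰⇒> 3≰n)))) (s≤s (n≤1+n 4)))

overlap≥2 : ∀ {a A B C E P Q} → 8 ≤ a + a → a + a ∸ 2 ≤ A + E → a + a ∸ 2 ≤ C + B
          → A + B ≤ a + P → C + E ≤ a + Q → 2 ≤ P ⊎ 2 ≤ Q
overlap≥2 {a} {A} {B} {C} {E} {P} {Q} 8≤2a AE CB AB CE with 2 ≤? P | 2 ≤? Q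
... | yes 2≤P | _       = inj₁ 2≤P
... | no  _   | yes 2≤Q = inj₂ 2≤Q
... | no  2≰P | no  2≰Q = ⊥-elim (≤⇒≯ (≤-trans 8≤2a (+-cancelˡ-≤ (a + a) _ _ 4a≤2a+6)) (s≤s (n≤1+n 6)))
  where
  open ≤-Reasoning
  regroup : ∀ A B C E → (2 + (A + E)) + (2 + (C + B)) ≡ 4 + ((A + B) + (C + E))
  regroup = solve-∀
  gather : ∀ a → 4 + ((a + 1) + (a + 1)) ≡ (a + a) + 6
  gather = solve-∀
  4a≤2a+6 : (a + a) + (a + a) ≤ (a + a) + 6
  4a≤2a+6 = begin
    (a + a) + (a + a)             ≤⟨ +-mono-≤ (≤-trans (m≤n+m∸n (a + a) 2) (+-monoʳ-≤ 2 AE))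
                                              (≤-trans (m≤n+m∸n (a + a) 2) (+-monoʳ-≤ 2 CB)) ⟩
    (2 + (A + E)) + (2 + (C + B)) ≡⟨ regroup A B C E ⟩
    4 + ((A + B) + (C + E))       ≤⟨ +-monoʳ-≤ 4 (+-mono-≤ AB CE) ⟩
    4 + ((a + P) + (a + Q))       ≤⟨ +-monoʳ-≤ 4 (+-mono-≤ (+-monoʳ-≤ a (s≤s⁻¹ (≰⇒> 2≰P)))
                                                            (+-monoʳ-≤ a (s≤s⁻¹ (≰⇒> 2≰Q)))) ⟩
    4 + ((a + 1) + (a + 1))       ≡⟨ gather a ⟩
    (a + a) + 6                   ∎

twoOfThree : ∀ {A : Set} {P : A → Set} {x y z} → P x ⊎ P y → P x ⊎ P z → P y ⊎ P z
           → (P x × P y) ⊎ (P x × P z) ⊎ (P y × P z)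
twoOfThree (inj₁ px) (inj₁ _)  (inj₁ py) = inj₁ (px , py)
twoOfThree (inj₁ px) (inj₁ _)  (inj₂ pz) = inj₂ (inj₁ (px , pz))
twoOfThree (inj₁ px) (inj₂ pz) _         = inj₂ (inj₁ (px , pz))
twoOfThree (inj₂ py) (inj₁ px) _         = inj₁ (px , py)
twoOfThree (inj₂ py) (inj₂ pz) _         = inj₂ (inj₂ (py , pz))

toℕ-nextIdx-< : ∀ {m} (i : Fin (suc m)) → toℕ i < m → toℕ (nextIdx i) ≡ suc (toℕ i)
toℕ-nextIdx-< i i<m = trans (toℕ-fromℕ< _) (m<n⇒m%n≡m (s≤s i<m))

toℕ-nextIdx-last : ∀ {m} (i : Fin (suc m)) → toℕ i ≡ m → toℕ (nextIdx i) ≡ 0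
toℕ-nextIdx-last {m} i i≡m = trans (toℕ-fromℕ< _) (trans (cong (λ k → suc k % suc m) i≡m) (n%n≡0 (suc m)))

nextIdx-surjective : ∀ {m} (k : Fin (suc m)) → ∃ λ i → nextIdx i ≡ k
nextIdx-surjective {m} fz = fromℕ m , toℕ-injective (toℕ-nextIdx-last (fromℕ m) (toℕ-fromℕ m))
nextIdx-surjective {m} (fs k) = inject₁ k , toℕ-injective (begin
  toℕ (nextIdx (inject₁ k)) ≡⟨ toℕ-nextIdx-< (inject₁ k) (subst (_< m) (sym (toℕ-inject₁ k)) (toℕ<n k)) ⟩
  suc (toℕ (inject₁ k))     ≡⟨ cong suc (toℕ-inject₁ k) ⟩
  suc (toℕ k)               ∎)
  where open ≡-Reasoning

two-vertices : ∀ {n} → 2 ≤ n → Σ (Fin n) λ u → Σ (Fin n) λ v → u ≢ v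
two-vertices (s≤s (s≤s _)) = fz , fs fz , λ ()

module _ {A : Set} where

  InjectiveOn : (ℕ → A) → ℕ → Set
  InjectiveOn f L = ∀ {i j} → i ≤ L → j ≤ L → f i ≡ f j → i ≡ j

  _◃_ : A → (ℕ → A) → ℕ → A
  (x ◃ f) zero    = x
  (x ◃ f) (suc k) = f k

  drop : ℕ → (ℕ → A) → ℕ → A
  drop j f k = f (j + k)

  injectiveOn-0 : ∀ {f} → InjectiveOn f 0
  injectiveOn-0 i≤0 j≤0 _ = trans (n≤0⇒n≡0 i≤0) (sym (n≤0⇒n≡0 j≤0))

  injectiveOn-≤ : ∀ {f L M} → M ≤ L → InjectiveOn f L → InjectiveOn f M
  injectiveOn-≤ M≤L inj i≤ j≤ = inj (≤-trans i≤ M≤L) (≤-trans j≤ M≤L)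

  injectiveOn-drop : ∀ {f L} j M → j + M ≤ L → InjectiveOn f L → InjectiveOn (drop j f) M
  injectiveOn-drop j M le inj i≤ k≤ eq =
    +-cancelˡ-≡ j _ _ (inj (≤-trans (+-monoʳ-≤ j i≤) le) (≤-trans (+-monoʳ-≤ j k≤) le) eq)

  injectiveOn-◃ : ∀ {f M} x → (∀ {k} → k ≤ M → f k ≢ x) → InjectiveOn f M → InjectiveOn (x ◃ f) (suc M)
  injectiveOn-◃ x fresh inj {zero}  {zero}  _  _  _  = refl
  injectiveOn-◃ x fresh inj {zero}  {suc j} _  j≤ eq = ⊥-elim (fresh (s≤s⁻¹ j≤) (sym eq))
  injectiveOn-◃ x fresh inj {suc i} {zero}  i≤ _  eq = ⊥-elim (fresh (s≤s⁻¹ i≤) eq)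
  injectiveOn-◃ x fresh inj {suc i} {suc j} i≤ j≤ eq = cong suc (inj (s≤s⁻¹ i≤) (s≤s⁻¹ j≤) eq)

module _ {n : ℕ} where

  OccursIn : (ℕ → Fin n) → ℕ → Fin n → Set
  OccursIn f L u = ∃ λ k → k ≤ L × f k ≡ u

  occursIn? : ∀ f L u → OccursIn f L u ⊎ (∀ {k} → k ≤ L → f k ≢ u)
  occursIn? f L u with any? (λ (i : Fin (suc L)) → f (toℕ i) ≟ u)
  ... | yes (i , eq) = inj₁ (toℕ i , s≤s⁻¹ (toℕ<n i) , eq)
  ... | no  none     = inj₂ λ {k} k≤ eq →
    none (fromℕ< (s≤s k≤) , subst (λ j → f j ≡ u) (sym (toℕ-fromℕ< (s≤s k≤))) eq)

  injectiveOn⇒≤ : ∀ {f L} → InjectiveOn f L → suc L ≤ n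
  injectiveOn⇒≤ {f} inj =
    injective⇒≤ {f = f ∘ toℕ} (toℕ-injective ∘ inj (s≤s⁻¹ (toℕ<n _)) (s≤s⁻¹ (toℕ<n _)))

  injectiveOn-full⇒occurs : ∀ {f L} → InjectiveOn f L → suc L ≡ n → ∀ u → OccursIn f L u
  injectiveOn-full⇒occurs {f} {L} inj refl u with occursIn? f L u
  ... | inj₁ occ  = occ
  ... | inj₂ miss = ⊥-elim (1+n≰n (injective⇒≤ {f = λ i → punchOut (u≢f i)} λ {i} {j} eq →
                      toℕ-injective (inj (index≤ i) (index≤ j) (punchOut-injective (u≢f i) (u≢f j) eq))))
    where
    index≤ : (i : Fin (suc L)) → toℕ i ≤ L
    index≤ i = s≤s⁻¹ (toℕ<n i)
    u≢f : (i : Fin (suc L)) → u ≢ f (toℕ i)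
    u≢f i = miss (index≤ i) ∘ sym

module _ {n} (D : Digraph n) where

  arc⇒≢ : ∀ {u v} → u ⟶[ D ] v → u ≢ v
  arc⇒≢ {u} u⟶u refl = subst T (noLoop D u) u⟶u

  dominatingPair? : Dec (∃ λ x → ∃ λ y → DominatingPair D x y)
  dominatingPair? = any? λ x → any? λ y → ¬? (x ≟ y) ×-dec commonHead? x y
    where
    commonHead? : ∀ x y → Dec (∃ λ z → (x ⟶[ D ] z) × (y ⟶[ D ] z))
    commonHead? x y = any? λ z → T? (arc D x z) ×-dec T? (arc D y z)

  walk-enters : ∀ {u v} (P : Fin n → Set) → (∀ w → Dec (P w)) → Reach D u v → ¬ P u → P v
              → ∃ λ s → ∃ λ t → s ⟶[ D ] t × ¬ P s × P t
  walk-enters P P? here ¬Pu Pv = ⊥-elim (¬Pu Pv)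
  walk-enters P P? (step {w = w} u⟶w walk) ¬Pu Pv with P? w
  ... | yes Pw = _ , w , u⟶w , ¬Pu , Pw
  ... | no ¬Pw = walk-enters P P? walk ¬Pw Pv

  ArcsOn : (ℕ → Fin n) → ℕ → Set
  ArcsOn f L = ∀ {k} → k < L → f k ⟶[ D ] f (suc k)

  arcsOn-≤ : ∀ {f L M} → M ≤ L → ArcsOn f L → ArcsOn f M
  arcsOn-≤ M≤L arcs k< = arcs (<-≤-trans k< M≤L)

  arcsOn-drop : ∀ {f L} j M → j + M ≤ L → ArcsOn f L → ArcsOn (drop j f) M
  arcsOn-drop {f} j M le arcs {k} k< =
    subst (λ i → f (j + k) ⟶[ D ] f i) (sym (+-suc j k)) (arcs (<-≤-trans (+-monoʳ-< j k<) le))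

  arcsOn-◃ : ∀ {f M} x → x ⟶[ D ] f 0 → ArcsOn f M → ArcsOn (x ◃ f) (suc M)
  arcsOn-◃ x x⟶ arcs {zero}  _  = x⟶
  arcsOn-◃ x x⟶ arcs {suc k} k< = arcs (s≤s⁻¹ k<)

  record Path (u v : Fin n) : Set where
    field
      len       : ℕ
      at        : ℕ → Fin n
      start     : at 0 ≡ u
      end       : at len ≡ v
      injective : InjectiveOn at len
      adjacent  : ArcsOn at len

  reach⇒path : ∀ {u v} → Reach D u v → Path u v
  reach⇒path {u} here = record
    { len = 0 ; at = λ _ → u ; start = refl ; end = refl ; injective = injectiveOn-0 ; adjacent = λ () }
  reach⇒path {u} (step u⟶w walk) with reach⇒path walk
  ... | P with occursIn? (Path.at P) (Path.len P) u
  ... | inj₁ (j , j≤ , at-j≡u) = record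
    { len = Path.len P ∸ j ; at = drop j (Path.at P)
    ; start = trans (cong (Path.at P) (+-identityʳ j)) at-j≡u
    ; end = trans (cong (Path.at P) (m+[n∸m]≡n j≤)) (Path.end P)
    ; injective = injectiveOn-drop j _ (≤-reflexive (m+[n∸m]≡n j≤)) (Path.injective P)
    ; adjacent = arcsOn-drop j _ (≤-reflexive (m+[n∸m]≡n j≤)) (Path.adjacent P) }
  ... | inj₂ u∉P = record
    { len = suc (Path.len P) ; at = u ◃ Path.at P ; start = refl ; end = Path.end P
    ; injective = injectiveOn-◃ u u∉P (Path.injective P)
    ; adjacent = arcsOn-◃ u (subst (u ⟶[ D ]_) (sym (Path.start P)) u⟶w) (Path.adjacent P) }

  -- A loop has the len + 1 vertices at 0, …, at len.
  record Loop : Set where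
    field
      len       : ℕ
      at        : ℕ → Fin n
      injective : InjectiveOn at len
      adjacent  : ArcsOn at len
      closing   : at len ⟶[ D ] at 0

  path+arc⇒loop : ∀ {u v} → Path u v → v ⟶[ D ] u → Loop
  path+arc⇒loop P v⟶u = record
    { len = len ; at = at ; injective = injective ; adjacent = adjacent
    ; closing = subst₂ (_⟶[ D ]_) (sym end) (sym start) v⟶u }
    where open Path P

  arc+path⇒loop : ∀ {u v} → u ⟶[ D ] v → Path v u → Loop
  arc+path⇒loop {u} u⟶v P = record
    { len = len ; at = u ◃ at ; injective = injective′ ; adjacent = adjacent′ ; closing = closing′ end adjacent }
    where
    open Path P
    injective′ : InjectiveOn (u ◃ at) len
    injective′ {zero}  {zero}  _  _  _  = refl
    injective′ {zero}  {suc j} _  j< eq = ⊥-elim (<⇒≢ j< (injective (<⇒≤ j<) ≤-refl (trans (sym eq) (sym end))))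
    injective′ {suc i} {zero}  i< _  eq = ⊥-elim (<⇒≢ i< (injective (<⇒≤ i<) ≤-refl (trans eq (sym end))))
    injective′ {suc i} {suc j} i< j< eq = cong suc (injective (<⇒≤ i<) (<⇒≤ j<) eq)
    adjacent′ : ArcsOn (u ◃ at) len
    adjacent′ {zero}  _  = subst (u ⟶[ D ]_) (sym start) u⟶v
    adjacent′ {suc k} k< = adjacent (<-trans (n<1+n k) k<)
    closing′ : ∀ {L} → at L ≡ u → ArcsOn at L → (u ◃ at) L ⟶[ D ] u
    closing′ {zero}  at-0≡u _    = ⊥-elim (arc⇒≢ u⟶v (trans (sym at-0≡u) start))
    closing′ {suc M} at-L≡u arcs = subst (at M ⟶[ D ]_) at-L≡u (arcs (n<1+n M))

  square : ∀ {x p y q} → x ⟶[ D ] p → p ⟶[ D ] y → y ⟶[ D ] q → q ⟶[ D ] x → x ≢ y → p ≢ q → Loop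
  square {x} {p} {y} {q} x⟶p p⟶y y⟶q q⟶x x≢y p≢q = record
    { len = 3 ; at = x ◃ (p ◃ (y ◃ (q ◃ λ _ → x)))
    ; injective = injectiveOn-◃ x x-fresh (injectiveOn-◃ p p-fresh (injectiveOn-◃ y y-fresh injectiveOn-0))
    ; adjacent = λ { {0} _ → x⟶p ; {1} _ → p⟶y ; {2} _ → y⟶q ; {suc (suc (suc _))} (s≤s (s≤s (s≤s ()))) }
    ; closing = q⟶x }
    where
    x-fresh : ∀ {k} → k ≤ 2 → (p ◃ (y ◃ (q ◃ λ _ → x))) k ≢ x
    x-fresh {0} _ = arc⇒≢ x⟶p ∘ sym
    x-fresh {1} _ = x≢y ∘ sym
    x-fresh {2} _ = arc⇒≢ q⟶x
    x-fresh {suc (suc (suc _))} (s≤s (s≤s ()))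
    p-fresh : ∀ {k} → k ≤ 1 → (y ◃ (q ◃ λ _ → x)) k ≢ p
    p-fresh {0} _ = arc⇒≢ p⟶y ∘ sym
    p-fresh {1} _ = p≢q ∘ sym
    p-fresh {suc (suc _)} (s≤s ())
    y-fresh : ∀ {k} → k ≤ 0 → (q ◃ λ _ → x) k ≢ y
    y-fresh {0} _ = arc⇒≢ y⟶q ∘ sym

  asymmetricOut⇒loop : ∀ {x y} → x ⟶[ D ] y → ¬ (y ⟶[ D ] x) → Reach D y x
                     → Σ Loop λ ℓ → Loop.at ℓ 0 ≡ x × Loop.len ℓ ≢ 1
  asymmetricOut⇒loop {x} x⟶y y↛x walk = ℓ , refl , len≢1
    where
    P = reach⇒path walk
    ℓ = arc+path⇒loop x⟶y P
    len≢1 : Loop.len ℓ ≢ 1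
    len≢1 len≡1 = y↛x (subst₂ (_⟶[ D ]_) (Path.start P) refl
                         (subst (λ k → Loop.at ℓ k ⟶[ D ] x) len≡1 (Loop.closing ℓ)))

  asymmetricIn⇒loop : ∀ {x y} → y ⟶[ D ] x → ¬ (x ⟶[ D ] y) → Reach D x y
                    → Σ Loop λ ℓ → Loop.at ℓ 0 ≡ x × Loop.len ℓ ≢ 1
  asymmetricIn⇒loop {x} y⟶x x↛y walk = path+arc⇒loop P y⟶x , start , len≢1
    where
    P = reach⇒path walk
    open Path P
    len≢1 : len ≢ 1
    len≢1 len≡1 = x↛y (subst₂ (_⟶[ D ]_) start (trans (cong at (sym len≡1)) end)
                         (adjacent (subst (0 <_) (sym len≡1) (s≤s z≤n))))

  loop-exists : 2 ≤ n → StronglyConnected D → Loop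
  loop-exists 2≤n strong with two-vertices 2≤n
  ... | u , v , u≢v with strong u v
  ...   | here               = ⊥-elim (u≢v refl)
  ...   | step {w = w} u⟶w _ = arc+path⇒loop u⟶w (reach⇒path (strong w u))

  module _ (ℓ : Loop) where
    open Loop ℓ

    loop-len≢0 : len ≢ 0
    loop-len≢0 len≡0 = arc⇒≢ (subst (λ k → at k ⟶[ D ] at 0) len≡0 closing) refl

    loop-lastArc : at (len ∸ 1) ⟶[ D ] at len
    loop-lastArc = lastArc loop-len≢0 adjacent
      where
      lastArc : ∀ {L} → L ≢ 0 → ArcsOn at L → at (L ∸ 1) ⟶[ D ] at L
      lastArc {zero}  L≢0 _    = ⊥-elim (L≢0 refl)
      lastArc {suc M} _   arcs = arcs (n<1+n M)

    closeEarly : ∀ j → j ≤ len → at j ⟶[ D ] at 0 → Loop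
    closeEarly j j≤len chord = record
      { len = j ; at = at ; injective = injectiveOn-≤ j≤len injective
      ; adjacent = arcsOn-≤ j≤len adjacent ; closing = chord }

    jumpAhead : ∀ j → 1 ≤ j → j ≤ len → at 0 ⟶[ D ] at j → Loop
    jumpAhead j 1≤j j≤len chord = record
      { len = suc (len ∸ j) ; at = at 0 ◃ drop j at
      ; injective = injectiveOn-◃ (at 0) fresh (injectiveOn-drop j _ j+rest≤len injective)
      ; adjacent = arcsOn-◃ (at 0) (subst (λ i → at 0 ⟶[ D ] at i) (sym (+-identityʳ j)) chord)
                              (arcsOn-drop j _ j+rest≤len adjacent)
      ; closing = subst (λ i → at i ⟶[ D ] at 0) (sym (m+[n∸m]≡n j≤len)) closing }
      where
      j+rest≤len : j + (len ∸ j) ≤ len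
      j+rest≤len = ≤-reflexive (m+[n∸m]≡n j≤len)
      fresh : ∀ {k} → k ≤ len ∸ j → at (j + k) ≢ at 0
      fresh {k} k≤ eq = 1+n≰n (≤-trans (≤-trans 1≤j (m≤m+n j k))
                          (≤-reflexive (injective (≤-trans (+-monoʳ-≤ j k≤) j+rest≤len) z≤n eq)))

    toCycle : Cycle D len
    toCycle = record
      { vtx = at ∘ toℕ
      ; len≥2 = s≤s (n≢0⇒n>0 loop-len≢0)
      ; distinct = toℕ-injective ∘ injective (index≤ _) (index≤ _)
      ; arcs = cycleArc }
      where
      index≤ : (i : Fin (suc len)) → toℕ i ≤ len
      index≤ i = s≤s⁻¹ (toℕ<n i)
      cycleArc : ∀ i → at (toℕ i) ⟶[ D ] at (toℕ (nextIdx i))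
      cycleArc i with m≤n⇒m<n∨m≡n (index≤ i)
      ... | inj₁ i<len rewrite toℕ-nextIdx-< i i<len = adjacent i<len
      ... | inj₂ i≡len rewrite toℕ-nextIdx-last i i≡len | i≡len = closing

    nonHamiltonian : 3 ≤ len → suc len < n → HasNonHamCycleLen≥4 D
    nonHamiltonian 3≤len short = len , toCycle , s≤s 3≤len , short

  module _ (strong : StronglyConnected D) (noPair : ∀ x y → ¬ DominatingPair D x y) where

    commonHead⇒≡ : ∀ {u v z} → u ⟶[ D ] z → v ⟶[ D ] z → u ≡ v
    commonHead⇒≡ {u} {v} u⟶z v⟶z with u ≟ v
    ... | yes u≡v = u≡v
    ... | no  u≢v = ⊥-elim (noPair u v (u≢v , _ , u⟶z , v⟶z))

    module _ {m} (C : Cycle D m) where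

      OnCycle : Fin n → Set
      OnCycle u = ∃ λ k → vtx C k ≡ u

      arc-into-cycle : ∀ {s t} → s ⟶[ D ] t → OnCycle t
                     → Σ (Fin (suc m)) λ i → vtx C i ≡ s × vtx C (nextIdx i) ≡ t
      arc-into-cycle s⟶t (k , C-k≡t) with nextIdx-surjective k
      ... | i , next≡k = i , commonHead⇒≡ (subst (vtx C i ⟶[ D ]_) next-i≡t (arcs C i)) s⟶t , next-i≡t
        where
        next-i≡t : vtx C (nextIdx i) ≡ _
        next-i≡t = trans (cong (vtx C) next≡k) C-k≡t

      cycle-covers : ∀ u → OnCycle u
      cycle-covers u with any? (λ k → vtx C k ≟ u)
      ... | yes onC = onC
      ... | no  offC with walk-enters OnCycle (λ w → any? (λ k → vtx C k ≟ w)) (strong u (vtx C fz)) offC (fz , refl)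
      ...   | s , t , s⟶t , offS , onT with arc-into-cycle s⟶t onT
      ...     | i , C-i≡s , _ = ⊥-elim (offS (i , C-i≡s))

      cycle-hamiltonian : suc m ≡ n
      cycle-hamiltonian = ≤-antisym (injective⇒≤ (distinct C))
        (injective⇒≤ {f = proj₁ ∘ cycle-covers} λ {u} {v} eq →
          trans (sym (proj₂ (cycle-covers u))) (trans (cong (vtx C) eq) (proj₂ (cycle-covers v))))

    noDominatingPair⇒isDirectedCycle : 2 ≤ n → IsDirectedCycle D
    noDominatingPair⇒isDirectedCycle 2≤n =
      Loop.len ℓ , C , cycle-hamiltonian C , λ s t s⟶t → arc-into-cycle C s⟶t (cycle-covers C t)
      where
      ℓ = loop-exists 2≤n strong
      C = toCycle ℓ

module Bipartite {n} (D : Digraph n) (side : Fin n → Bool)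
                 (bipartite : ∀ x y → x ⟶[ D ] y → side x ≢ side y) where

  arc-side : ∀ {u v} → u ⟶[ D ] v → side u ≡ not (side v)
  arc-side {u} {v} u⟶v = ¬-not (bipartite u v u⟶v)

  twoStep-side : ∀ {u v w} → u ⟶[ D ] v → v ⟶[ D ] w → side u ≡ side w
  twoStep-side {w = w} u⟶v v⟶w = trans (arc-side u⟶v) (trans (cong not (arc-side v⟶w)) (not-involutive (side w)))

  commonHead-side : ∀ {u v w} → u ⟶[ D ] w → v ⟶[ D ] w → side u ≡ side v
  commonHead-side u⟶w v⟶w = trans (arc-side u⟶w) (sym (arc-side v⟶w))

  noTriangle : ∀ {u v w} → u ⟶[ D ] v → v ⟶[ D ] w → ¬ (w ⟶[ D ] u)
  noTriangle u⟶v v⟶w w⟶u = bipartite _ _ w⟶u (sym (twoStep-side u⟶v v⟶w))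

  module _ (ℓ : Loop D) where
    open Loop ℓ

    loop-len≥3 : len ≢ 1 → 3 ≤ len
    loop-len≥3 len≢1 = ≢0∧≢1∧≢2⇒≥3 (loop-len≢0 D ℓ) len≢1 λ len≡2 →
      noTriangle (adjacent (subst (0 <_) (sym len≡2) (s≤s z≤n)))
                 (adjacent (subst (1 <_) (sym len≡2) (s≤s (s≤s z≤n))))
                 (subst (λ k → at k ⟶[ D ] at 0) len≡2 closing)

    -- On a hamiltonian loop, an out- (in-)neighbour at j of x = at 0 other than at 1 and at len is a
    -- chord.  As there are no triangles, j ≠ len − 1 (resp. j ≠ 2), so the cycle it cuts off still
    -- has length at least 4, and it misses at 1 (resp. at len).
    module _ (hamiltonian : suc len ≡ n) where

      outChord : 3 ≤ outdeg D (at 0) → HasNonHamCycleLen≥4 D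
      outChord 3≤out with length<count⇒∃∉ (arc D (at 0)) (at 1 ∷ at len ∷ []) 3≤out
      ... | w , 0⟶w , w∉ with injectiveOn-full⇒occurs injective hamiltonian w
      ... | j , j≤len , at-j≡w =
        nonHamiltonian D (jumpAhead D ℓ j (n≢0⇒n>0 j≢0) j≤len 0⟶j) (s≤s (≢0∧≢1⇒≥2 rest≢0 rest≢1)) short
        where
        0⟶j : at 0 ⟶[ D ] at j
        0⟶j = subst (at 0 ⟶[ D ]_) (sym at-j≡w) 0⟶w
        j≢0 : j ≢ 0
        j≢0 refl = arc⇒≢ D 0⟶j refl
        j≢1 : j ≢ 1
        j≢1 refl = w∉ (here (sym at-j≡w))
        rest≢0 : len ∸ j ≢ 0
        rest≢0 rest≡0 =
          w∉ (there (here (trans (sym at-j≡w) (cong at (≤-antisym j≤len (m∸n≡0⇒m≤n rest≡0))))))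
        rest≢1 : len ∸ j ≢ 1
        rest≢1 rest≡1 = noTriangle (subst (λ k → at k ⟶[ D ] at len) len∸1≡j (loop-lastArc D ℓ)) closing 0⟶j
          where
          len∸1≡j : len ∸ 1 ≡ j
          len∸1≡j = trans (cong (len ∸_) (sym rest≡1)) (m∸[m∸n]≡n j≤len)
        short : suc (suc (suc (len ∸ j))) ≤ n
        short = subst (suc (suc (suc (len ∸ j))) ≤_) hamiltonian
                  (s≤s (≤-trans (+-monoˡ-≤ (len ∸ j) (≢0∧≢1⇒≥2 j≢0 j≢1))
                                (≤-reflexive (m+[n∸m]≡n j≤len))))

      inChord : 3 ≤ indeg D (at 0) → HasNonHamCycleLen≥4 D
      inChord 3≤in with length<count⇒∃∉ (λ v → arc D v (at 0)) (at 1 ∷ at len ∷ []) 3≤in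
      ... | w , w⟶0 , w∉ with injectiveOn-full⇒occurs injective hamiltonian w
      ... | j , j≤len , at-j≡w =
        nonHamiltonian D (closeEarly D ℓ j j≤len j⟶0) (≢0∧≢1∧≢2⇒≥3 j≢0 j≢1 j≢2) short
        where
        j⟶0 : at j ⟶[ D ] at 0
        j⟶0 = subst (_⟶[ D ] at 0) (sym at-j≡w) w⟶0
        j≢0 : j ≢ 0
        j≢0 refl = arc⇒≢ D j⟶0 refl
        j≢1 : j ≢ 1
        j≢1 refl = w∉ (here (sym at-j≡w))
        j<len : j < len
        j<len = ≤∧≢⇒< j≤len λ { refl → w∉ (there (here (sym at-j≡w))) }
        j≢2 : j ≢ 2
        j≢2 refl = noTriangle (adjacent (<-trans (s≤s z≤n) j<len)) (adjacent (<⇒≤ j<len)) j⟶0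
        short : suc (suc j) ≤ n
        short = subst (suc (suc j) ≤_) hamiltonian (s≤s j<len)

  loop⇒nonHamCycle : (ℓ : Loop D) → 3 ≤ Loop.len ℓ
                   → 3 ≤ outdeg D (Loop.at ℓ 0) ⊎ 3 ≤ indeg D (Loop.at ℓ 0) → HasNonHamCycleLen≥4 D
  loop⇒nonHamCycle ℓ 3≤len busy with m≤n⇒m<n∨m≡n (injectiveOn⇒≤ (Loop.injective ℓ))
  ... | inj₁ short       = nonHamiltonian D ℓ 3≤len short
  ... | inj₂ hamiltonian = [ outChord ℓ hamiltonian , inChord ℓ hamiltonian ]′ busy

module Balanced (a : ℕ) (a≥4 : 4 ≤ a) (D : Digraph (a + a)) (side : Fin (a + a) → Bool)
                (bip : BalancedBipartite a D side) where

  open Bipartite D side (proj₂ bip)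

  8≤a+a : 8 ≤ a + a
  8≤a+a = +-mono-≤ a≥4 a≥4

  High : Fin (a + a) → Set
  High v = a + a ∸ 2 ≤ deg D v

  high⇒3≤out⊎3≤in : ∀ {x} → High x → 3 ≤ outdeg D x ⊎ 3 ≤ indeg D x
  high⇒3≤out⊎3≤in high-x = 6≤m+n⇒3≤m⊎3≤n (≤-trans (∸-monoˡ-≤ 2 8≤a+a) high-x)

  count-within-side : ∀ {p : Fin (a + a) → Bool} c → (∀ v → T (p v) → side v ≡ c) → count p ≤ a
  count-within-side true  p⊆c = ≤-trans (count-mono {q = side} λ v pv → subst T (sym (p⊆c v pv)) tt)
                                         (≤-reflexive (proj₁ bip))
  count-within-side false p⊆c = ≤-trans (count-mono {q = not ∘ side} λ v pv → subst (T ∘ not) (sym (p⊆c v pv)) tt)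
                                         (≤-reflexive count-other-side)
    where
    count-other-side : count (not ∘ side) ≡ a
    count-other-side = +-cancelˡ-≡ a _ _ (trans (cong (_+ count (not ∘ side)) (sym (proj₁ bip))) (count-not side))

  count+count≤a+count∧ : ∀ {p q : Fin (a + a) → Bool} c
                       → (∀ v → T (p v) → side v ≡ c) → (∀ v → T (q v) → side v ≡ c)
                       → count p + count q ≤ a + count (λ v → p v ∧ q v)
  count+count≤a+count∧ {p} {q} c p⊆c q⊆c = begin
    count p + count q                                 ≡⟨ count-∨+∧ p q ⟨
    count (λ v → p v ∨ q v) + count (λ v → p v ∧ q v) ≤⟨ +-monoˡ-≤ _ (count-within-side c p∨q⊆c) ⟩
    a + count (λ v → p v ∧ q v)                       ∎
    where
    open ≤-Reasoning
    p∨q⊆c : ∀ v → T (p v ∨ q v) → side v ≡ c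
    p∨q⊆c v = [ p⊆c v , q⊆c v ]′ ∘ Equivalence.to T-∨

  twoStepPaths⇒nonHamCycle : ∀ {x p q} → x ⟶[ D ] p → q ⟶[ D ] x → p ≢ q
                           → 2 ≤ count (λ v → arc D p v ∧ arc D v q) → HasNonHamCycleLen≥4 D
  twoStepPaths⇒nonHamCycle {x} x⟶p q⟶x p≢q 2≤paths with length<count⇒∃∉ _ (x ∷ []) 2≤paths
  ... | y , p⟶y⟶q , y∉[x] =
    nonHamiltonian D
      (square D x⟶p (proj₁ p⟶y×y⟶q) (proj₂ p⟶y×y⟶q) q⟶x (λ x≡y → y∉[x] (here (sym x≡y))) p≢q)
                     (s≤s (s≤s (s≤s z≤n))) (≤-trans (s≤s (s≤s (s≤s (s≤s (s≤s z≤n))))) 8≤a+a)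
    where
    p⟶y×y⟶q = Equivalence.to T-∧ p⟶y⟶q

  highPair⇒nonHamCycle : ∀ {x p q} → p ≢ q → x ⟶[ D ] p → p ⟶[ D ] x → x ⟶[ D ] q → q ⟶[ D ] x
                       → High p → High q → HasNonHamCycleLen≥4 D
  highPair⇒nonHamCycle {x} {p} {q} p≢q x⟶p p⟶x x⟶q q⟶x high-p high-q =
    [ twoStepPaths⇒nonHamCycle x⟶p q⟶x p≢q , twoStepPaths⇒nonHamCycle x⟶q p⟶x (p≢q ∘ sym) ]′
    (overlap≥2 {A = outdeg D p} {indeg D q} {outdeg D q} {indeg D p} 8≤a+a high-p high-q
       (count+count≤a+count∧ {p = arc D p} {q = λ v → arc D v q} (side x) out-p in-q)
       (count+count≤a+count∧ {p = arc D q} {q = λ v → arc D v p} (side x) out-q in-p))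
    where
    out-p : ∀ v → p ⟶[ D ] v → side v ≡ side x
    out-p v p⟶v = sym (twoStep-side x⟶p p⟶v)
    out-q : ∀ v → q ⟶[ D ] v → side v ≡ side x
    out-q v q⟶v = sym (twoStep-side x⟶q q⟶v)
    in-p : ∀ v → v ⟶[ D ] p → side v ≡ side x
    in-p v v⟶p = commonHead-side v⟶p x⟶p
    in-q : ∀ v → v ⟶[ D ] q → side v ≡ side x
    in-q v v⟶q = commonHead-side v⟶q x⟶q

  loopThrough⇒nonHamCycle : ∀ {x} → High x → (Σ (Loop D) λ ℓ → Loop.at ℓ 0 ≡ x × Loop.len ℓ ≢ 1)
                          → HasNonHamCycleLen≥4 D
  loopThrough⇒nonHamCycle high-x (ℓ , at-0≡x , len≢1) =
    loop⇒nonHamCycle ℓ (loop-len≥3 ℓ len≢1)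
      (subst (λ v → 3 ≤ outdeg D v ⊎ 3 ≤ indeg D v) (sym at-0≡x) (high⇒3≤out⊎3≤in high-x))

  module DegreeCondition (strong : StronglyConnected D)
                         (dominating : ∀ x y → DominatingPair D x y → High x ⊎ High y) where

    commonHead⇒high : ∀ {u v z} → u ≢ v → u ⟶[ D ] z → v ⟶[ D ] z → High u ⊎ High v
    commonHead⇒high u≢v u⟶z v⟶z = dominating _ _ (u≢v , _ , u⟶z , v⟶z)

    threeOutNeighbours⇒nonHamCycle : ∀ {x} → (∀ v → x ⟶[ D ] v → v ⟶[ D ] x)
      → (∃ λ y₁ → ∃ λ y₂ → ∃ λ y₃ → (x ⟶[ D ] y₁ × x ⟶[ D ] y₂ × x ⟶[ D ] y₃)
                                  × (y₁ ≢ y₂ × y₁ ≢ y₃ × y₂ ≢ y₃))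
      → HasNonHamCycleLen≥4 D
    threeOutNeighbours⇒nonHamCycle {x} back (y₁ , y₂ , y₃ , (x⟶y₁ , x⟶y₂ , x⟶y₃) , (y₁≢y₂ , y₁≢y₃ , y₂≢y₃)) =
      [ uncurry (highPair y₁≢y₂ x⟶y₁ x⟶y₂)
      , [ uncurry (highPair y₁≢y₃ x⟶y₁ x⟶y₃) , uncurry (highPair y₂≢y₃ x⟶y₂ x⟶y₃) ]′ ]′
      (twoOfThree {P = High} (oneHigh y₁≢y₂ x⟶y₁ x⟶y₂) (oneHigh y₁≢y₃ x⟶y₁ x⟶y₃)
                             (oneHigh y₂≢y₃ x⟶y₂ x⟶y₃))
      where
      oneHigh : ∀ {p q} → p ≢ q → x ⟶[ D ] p → x ⟶[ D ] q → High p ⊎ High q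
      oneHigh p≢q x⟶p x⟶q = commonHead⇒high p≢q (back _ x⟶p) (back _ x⟶q)
      highPair : ∀ {p q} → p ≢ q → x ⟶[ D ] p → x ⟶[ D ] q → High p → High q → HasNonHamCycleLen≥4 D
      highPair p≢q x⟶p x⟶q = highPair⇒nonHamCycle p≢q x⟶p (back _ x⟶p) x⟶q (back _ x⟶q)

    symmetricVertex⇒nonHamCycle : ∀ x → High x → (∀ v → x ⟶[ D ] v → v ⟶[ D ] x)
                                → (∀ v → v ⟶[ D ] x → x ⟶[ D ] v) → HasNonHamCycleLen≥4 D
    symmetricVertex⇒nonHamCycle x high-x back forth =
      threeOutNeighbours⇒nonHamCycle back (3≤count⇒three (arc D x) 3≤out)
      where
      3≤out : 3 ≤ outdeg D x
      3≤out = [ id , (λ 3≤in → ≤-trans 3≤in (count-mono {p = λ v → arc D v x} {q = arc D x} forth)) ]′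
                (high⇒3≤out⊎3≤in high-x)

    highVertex⇒nonHamCycle : ∀ x → High x → HasNonHamCycleLen≥4 D
    highVertex⇒nonHamCycle x high-x with any? (λ y → T? (arc D x y) ×-dec ¬? (T? (arc D y x)))
    ... | yes (y , x⟶y , y↛x) = loopThrough⇒nonHamCycle high-x (asymmetricOut⇒loop D x⟶y y↛x (strong y x))
    ... | no noAsymOut with any? (λ y → T? (arc D y x) ×-dec ¬? (T? (arc D x y)))
    ...   | yes (y , y⟶x , x↛y) = loopThrough⇒nonHamCycle high-x (asymmetricIn⇒loop D y⟶x x↛y (strong x y))
    ...   | no noAsymIn = symmetricVertex⇒nonHamCycle x high-x
              (λ v x⟶v → decidable-stable (T? _) λ v↛x → noAsymOut (v , x⟶v , v↛x))
              (λ v v⟶x → decidable-stable (T? _) λ x↛v → noAsymIn (v , v⟶x , x↛v))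

lemma4p4 : (a : ℕ) → 4 ≤ a → (D : Digraph (a + a)) → (side : Fin (a + a) → Bool)
    → BalancedBipartite a D side
    → StronglyConnected D
    → ¬ IsDirectedCycle D
    → (∀ x y → DominatingPair D x y → (a + a) ∸ 2 ≤ deg D x ⊔ deg D y)
    → HasNonHamCycleLen≥4 D
lemma4p4 a a≥4 D side bip strong notCycle maxDeg with dominatingPair? D
... | no noPair = ⊥-elim (notCycle (noDominatingPair⇒isDirectedCycle D strong (λ x y xy → noPair (x , y , xy))
                                      (≤-trans (s≤s (s≤s z≤n)) 8≤a+a)))
  where open Balanced a a≥4 D side bip using (8≤a+a)
... | yes (x , y , xy) = [ highVertex⇒nonHamCycle x , highVertex⇒nonHamCycle y ]′ (≤⊔⇒≤⊎≤ (maxDeg x y xy))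
  where
  open Balanced a a≥4 D side bip
  open DegreeCondition strong (λ x y xy → ≤⊔⇒≤⊎≤ (maxDeg x y xy))
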